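{- Let $r\ge 1$ and $n\ge 1$ be integers. For nonnegative integers $\alpha_1,\dots,\alpha_r$ with $\sum_{i=1}^r i\alpha_i=n$, let $\mathcal{O}_n(\alpha_1,\dots,\alpha_r)$ be the number of preference orderings of an $n$-element set having exactly $\alpha_i$ blocks of size $i$ for each $i$. Then, as polynomials in $x_1,\dots,x_r$, $$n!\,F^{[r]}_{n+r-1}\Big(x_1,\tfrac{1}{2!}x_2,\tfrac{1}{3!}x_3,\dots,\tfrac{1}{r!}x_r\Big)=\sum_{\substack{\alpha_1,\dots,\alpha_r\ge 0\\ \sum_{i=1}^r i\alpha_i=n}}\mathcal{O}_n(\alpha_1,\dots,\alpha_r)\,x_1^{\alpha_1}x_2^{\alpha_2}\cdots x_r^{\alpha_r}.$$
   Context: For an integer $r\ge 1$, the $r$-Fibonacci polynomial $F^{[r]}_n(x_1,\dots,x_r)$ is defined by $F^{[r]}_n=0$ for $0\le n<r-1$, $F^{[r]}_{r-1}=1$, and $F^{[r]}_n=\sum_{i=1}^r x_iF^{[r]}_{n-i}$ for $n\ge r$. A preference ordering of a finite set is an ordered set partition: a partition of the set into nonempty blocks together with a linear order on the blocks. -}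

module Defs where

open import Data.Nat as ℕ using (ℕ; zero; suc; _∸_; _!; _<ᵇ_; _≡ᵇ_)
open import Data.Nat.Properties using (_!≢0)
open import Data.Bool using (if_then_else_)
open import Data.Integer using (+_)
open import Data.Fin using (Fin; toℕ)
open import Data.Fin.Properties using (all?)
import Data.Fin.Properties as FinP
open import Data.List using (List; []; _∷_; map; filter; length; foldr; concatMap; allFin; upTo)
open import Data.Product using (_×_)
open import Relation.Nullary.Decidable using (Dec; _×-dec_)
open import Relation.Binary.PropositionalEquality using (_≡_)
open import Data.Rational using (ℚ; 0ℚ; 1ℚ; _+_; _*_; _/_)

Σℚ : {A : Set} → List A → (A → ℚ) → ℚ
Σℚ xs f = foldr (λ a acc → f a + acc) 0ℚ xs

Πℚ : {A : Set} → List A → (A → ℚ) → ℚ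
Πℚ xs f = foldr (λ a acc → f a * acc) 1ℚ xs

powℚ : ℚ → ℕ → ℚ
powℚ q zero    = 1ℚ
powℚ q (suc k) = q * powℚ q k

toℚ : ℕ → ℚ
toℚ m = + m / 1

invFact : ℕ → ℚ
invFact k = (+ 1 / (k !)) {{k !≢0}}

nth : List ℚ → ℕ → ℚ
nth []       _       = 0ℚ
nth (q ∷ qs) zero    = q
nth (q ∷ qs) (suc k) = nth qs k

-- r-Fibonacci polynomials, evaluated at x = (x₁,…,x_r) ∈ ℚ^r.
-- x i  (i : Fin r) stands for x_{toℕ i + 1}.
--   F_n = 0 for n < r-1,  F_{r-1} = 1,  F_n = Σ_{i=1}^r x_i F_{n-i} for n ≥ r.
-- 'prevs n' is the list [F_{n-1}, …, F_0], so  nth (prevs n) (i-1) = F_{n-i}.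

module _ (r : ℕ) (x : Fin r → ℚ) where
  fibStep : ℕ → List ℚ → ℚ
  fibStep n prev =
    if n <ᵇ (r ∸ 1) then 0ℚ
    else if n ≡ᵇ (r ∸ 1) then 1ℚ
    else Σℚ (allFin r) (λ i → x i * nth prev (toℕ i))

  mutual
    Fib : ℕ → ℚ
    Fib n = fibStep n (prevs n)

    prevs : ℕ → List ℚ
    prevs zero    = []
    prevs (suc n) = Fib n ∷ prevs n

allFuns : (n k : ℕ) → List (Fin n → Fin k)
allFuns zero    k = (λ ()) ∷ []
allFuns (suc n) k =
  concatMap (λ f → map (λ j → λ { Fin.zero → j ; (Fin.suc i) → f i }) (allFin k))
            (allFuns n k)

-- Preference orderings (ordered set partitions) of Fin n, encoded as
-- surjections f : Fin n → Fin k for some k: the blocks are the fibres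
-- f⁻¹(0), f⁻¹(1), …, f⁻¹(k-1), in this order.  This is a bijective encoding.

blockSize : {n k : ℕ} → (Fin n → Fin k) → Fin k → ℕ
blockSize {n} f j = length (filter (λ i → f i FinP.≟ j) (allFin n))

numBlocksOfSize : {n k : ℕ} → (Fin n → Fin k) → ℕ → ℕ
numBlocksOfSize {n} {k} f s = length (filter (λ j → blockSize f j ℕ.≟ s) (allFin k))

-- f is an ordered set partition (all blocks nonempty) having exactly α_i
-- blocks of size i for each i = 1..r   (α i  stands for α_{toℕ i + 1})
IsPrefOrdering : {n k r : ℕ} → (Fin r → ℕ) → (Fin n → Fin k) → Set
IsPrefOrdering α f =
  (∀ j → 1 ℕ.≤ blockSize f j) × (∀ i → numBlocksOfSize f (suc (toℕ i)) ≡ α i)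

isPrefOrdering? : {n k r : ℕ} (α : Fin r → ℕ) (f : Fin n → Fin k) → Dec (IsPrefOrdering α f)
isPrefOrdering? α f =
  all? (λ j → 1 ℕ.≤? blockSize f j) ×-dec all? (λ i → numBlocksOfSize f (suc (toℕ i)) ℕ.≟ α i)

-- 𝒪_n(α₁,…,α_r): number of preference orderings of an n-element set (Fin n)
-- with exactly α_i blocks of size i.  A preference ordering of Fin n has at
-- most n blocks, so k ranges over 0..n.
𝒪 : (n : ℕ) {r : ℕ} → (Fin r → ℕ) → ℕ
𝒪 n α = foldr ℕ._+_ 0 (map (λ k → length (filter (isPrefOrdering? α) (allFuns n k))) (upTo (suc n)))

-- All α = (α₁,…,α_r) ∈ ℕ^r with Σ i·α_i = n  (necessarily α_i ≤ n).

weight : {r : ℕ} → (Fin r → ℕ) → ℕ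
weight {r} α = foldr ℕ._+_ 0 (map (λ i → suc (toℕ i) ℕ.* α i) (allFin r))

compositionsVec : (r n : ℕ) → List (Fin r → ℕ)
compositionsVec r n =
  filter (λ α → weight α ℕ.≟ n) (map (λ g i → toℕ (g i)) (allFuns r (suc n)))

monomial : {r : ℕ} → (Fin r → ℚ) → (Fin r → ℕ) → ℚ
monomial {r} x α = Πℚ (allFin r) (λ i → powℚ (x i) (α i))

{-# OPTIONS --safe #-}
module Submission where

-- Put φ(0) = 0, φ(i) = x_i for 1 ≤ i ≤ r and φ(i) = 0 for i > r, and let
-- (a ⋆ b)(n) = Σ_i C(n,i) a(i) b(n-i) be the binomial convolution, i.e. the product of exponential
-- generating functions.  Both sides of the identity, as sequences in n, solve the renewal equation
-- a(0) = 1, a(n+1) = (φ ⋆ a)(n+1), whose solution is unique because φ(0) = 0.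
-- For the left side this is the r-Fibonacci recurrence, since n!/i! = C(n,i) (n-i)!.
-- For the right side, a preference ordering of [n] with k blocks is a surjection f : [n] → [k]
-- whose monomial is Π_j φ(|f⁻¹ j|); this product vanishes exactly on the non-surjections and on the
-- orderings with a block larger than r, so the right side is Σ_k Σ_{f : [n] → [k]} Π_j φ(|f⁻¹ j|).
-- Splitting off the first element of [n] and applying the Leibniz rule (a ⋆ b)' = a' ⋆ b + a ⋆ b'
-- identifies the inner sum with the convolution power φ^{⋆k}(n), and Σ_k φ^{⋆k} = 1/(1 - φ) solves
-- the renewal equation.

open import Algebra.Bundles using (CommutativeMonoid; CommutativeSemigroup)
open import Algebra.Core using (Op₂)
open import Algebra.Structures using (IsCommutativeMonoid)
open import Data.Bool using (Bool; true; false; if_then_else_)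
open import Data.Bool.Properties using (if-∧; if-cong-then; if-float; if-swap-then)
open import Data.Fin as Fin using (Fin; toℕ)
open import Data.Fin.Properties using (all?; toℕ<n; ¬∀⟶∃¬)
open import Data.Integer as ℤ using (+_)
import Data.Integer.Properties as ℤ
open import Data.List using (List; []; _∷_; _++_; map; concatMap; foldr; filter; length; allFin; applyUpTo; upTo; tabulate)
open import Data.List.Membership.Propositional using (_∈_)
open import Data.List.Membership.Propositional.Properties using (∈-allFin)
open import Data.List.Properties using (map-tabulate; map-cong; length-filter; length-tabulate)
open import Data.List.Relation.Unary.Any using (here; there)
open import Data.Nat as ℕ using (ℕ; zero; suc; _≤_; _<_; z≤n; s≤s; z<s; _!; _∸_)
open import Data.Nat.Combinatorics using (_C_; nCk+nC[k+1]≡[n+1]C[k+1]; k>n⇒nCk≡0; nCk≡n!/k![n-k]!; k![n∸k]!∣n!)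
open import Data.Nat.Coprimality as Coprime using (1-coprimeTo)
open import Data.Nat.DivMod using (m/n*n≡m)
open import Data.Nat.Induction using (<-rec)
open import Data.Nat.Properties as ℕ using (_!≢0; _!*_!≢0)
open import Data.Product using (_,_)
open import Data.Rational as ℚ using (ℚ; mkℚ; 0ℚ; 1ℚ; _/_)
import Data.Rational.Properties as ℚ
open import Data.Sum using ([_,_]′)
import Data.Vec.Functional as Vector
open import Function using (_∘_; id)
open import Level using (0ℓ)
open import Relation.Binary.PropositionalEquality
open import Relation.Nullary using (does; Dec; yes; no)
open import Relation.Nullary.Decidable using (does-≡; map′; dec-true; dec-false)
open import Relation.Unary using (Decidable)

open import Defs

module BigOperators {A : Set} {_∙_ : Op₂ A} {ε : A} (isCM : IsCommutativeMonoid _≡_ _∙_ ε) where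

  open IsCommutativeMonoid isCM using (assoc; identityˡ; identityʳ)
  open ≡-Reasoning

  private
    commutativeSemigroup : CommutativeSemigroup 0ℓ 0ℓ
    commutativeSemigroup = record { isCommutativeSemigroup = IsCommutativeMonoid.isCommutativeSemigroup isCM }

  open import Algebra.Properties.CommutativeSemigroup commutativeSemigroup using (interchange)

  ∑ : {X : Set} → List X → (X → A) → A
  ∑ xs f = foldr (λ a acc → f a ∙ acc) ε xs

  ∑< : ℕ → (ℕ → A) → A
  ∑< zero    g = ε
  ∑< (suc n) g = g 0 ∙ ∑< n (g ∘ suc)

  variable
    X Y : Set

  ∑-cong : (xs : List X) {f g : X → A} → (∀ a → f a ≡ g a) → ∑ xs f ≡ ∑ xs g
  ∑-cong []       f≗g = refl
  ∑-cong (x ∷ xs) f≗g = cong₂ _∙_ (f≗g x) (∑-cong xs f≗g)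

  foldr-map≡∑ : (g : X → A) (xs : List X) → foldr _∙_ ε (map g xs) ≡ ∑ xs g
  foldr-map≡∑ g []       = refl
  foldr-map≡∑ g (x ∷ xs) = cong (g x ∙_) (foldr-map≡∑ g xs)

  ∑-++ : (xs ys : List X) (f : X → A) → ∑ (xs ++ ys) f ≡ ∑ xs f ∙ ∑ ys f
  ∑-++ []       ys f = sym (identityˡ (∑ ys f))
  ∑-++ (x ∷ xs) ys f = trans (cong (f x ∙_) (∑-++ xs ys f)) (sym (assoc (f x) (∑ xs f) (∑ ys f)))

  ∑-map : (h : X → Y) (xs : List X) (f : Y → A) → ∑ (map h xs) f ≡ ∑ xs (f ∘ h)
  ∑-map h []       f = refl
  ∑-map h (x ∷ xs) f = cong (f (h x) ∙_) (∑-map h xs f)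

  ∑-concatMap : (F : X → List Y) (xs : List X) (f : Y → A) → ∑ (concatMap F xs) f ≡ ∑ xs (λ a → ∑ (F a) f)
  ∑-concatMap F []       f = refl
  ∑-concatMap F (x ∷ xs) f = trans (∑-++ (F x) (concatMap F xs) f) (cong (∑ (F x) f ∙_) (∑-concatMap F xs f))

  ∑-∙ : (xs : List X) (f g : X → A) → ∑ xs (λ a → f a ∙ g a) ≡ ∑ xs f ∙ ∑ xs g
  ∑-∙ []       f g = sym (identityˡ ε)
  ∑-∙ (x ∷ xs) f g = trans (cong ((f x ∙ g x) ∙_) (∑-∙ xs f g)) (interchange (f x) (g x) (∑ xs f) (∑ xs g))

  ∑-ε : (xs : List X) {f : X → A} → (∀ a → f a ≡ ε) → ∑ xs f ≡ ε
  ∑-ε []       f≗ε = refl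
  ∑-ε (x ∷ xs) f≗ε = trans (cong₂ _∙_ (f≗ε x) (∑-ε xs f≗ε)) (identityˡ ε)

  ∑-comm : (xs : List X) (ys : List Y) (g : X → Y → A) →
           ∑ xs (λ a → ∑ ys (g a)) ≡ ∑ ys (λ b → ∑ xs (λ a → g a b))
  ∑-comm []       ys g = sym (∑-ε ys (λ _ → refl))
  ∑-comm (x ∷ xs) ys g =
    trans (cong (∑ ys (g x) ∙_) (∑-comm xs ys g)) (sym (∑-∙ ys (g x) (λ b → ∑ xs (λ a → g a b))))

  ∑-filter : {P : X → Set} (P? : Decidable P) (xs : List X) (f : X → A) →
             ∑ (filter P? xs) f ≡ ∑ xs (λ a → if does (P? a) then f a else ε)
  ∑-filter P? []       f = refl
  ∑-filter P? (x ∷ xs) f with does (P? x)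
  ... | true  = cong (f x ∙_) (∑-filter P? xs f)
  ... | false = trans (∑-filter P? xs f) (sym (identityˡ _))

  ∑-if : (b : Bool) (xs : List X) (f : X → A) → ∑ xs (λ a → if b then f a else ε) ≡ (if b then ∑ xs f else ε)
  ∑-if true  xs f = refl
  ∑-if false xs f = ∑-ε xs (λ _ → refl)

  ∑-absorbing : {z : A} → (∀ a → z ∙ a ≡ z) → (∀ a → a ∙ z ≡ z) →
                {xs : List X} {x : X} (f : X → A) → x ∈ xs → f x ≡ z → ∑ xs f ≡ z
  ∑-absorbing zˡ zʳ {_ ∷ xs} f (here refl)  fx≡z = trans (cong (_∙ ∑ xs f) fx≡z) (zˡ (∑ xs f))
  ∑-absorbing zˡ zʳ {y ∷ _}  f (there x∈xs) fx≡z = trans (cong (f y ∙_) (∑-absorbing zˡ zʳ f x∈xs fx≡z)) (zʳ (f y))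

  ∑-allFin-suc : (n : ℕ) (f : Fin (suc n) → A) → ∑ (allFin (suc n)) f ≡ f Fin.zero ∙ ∑ (allFin n) (f ∘ Fin.suc)
  ∑-allFin-suc n f = cong (f Fin.zero ∙_) (begin
    ∑ (tabulate Fin.suc) f          ≡⟨ cong (λ l → ∑ l f) (map-tabulate id Fin.suc) ⟨
    ∑ (map Fin.suc (allFin n)) f    ≡⟨ ∑-map Fin.suc (allFin n) f ⟩
    ∑ (allFin n) (f ∘ Fin.suc)      ∎)

  ∑-allFin-toℕ : (n : ℕ) (g : ℕ → A) → ∑ (allFin n) (g ∘ toℕ) ≡ ∑< n g
  ∑-allFin-toℕ zero    g = refl
  ∑-allFin-toℕ (suc n) g = trans (∑-allFin-suc n (g ∘ toℕ)) (cong (g 0 ∙_) (∑-allFin-toℕ n (g ∘ suc)))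

  ∑-applyUpTo : (f : ℕ → X) (n : ℕ) (g : X → A) → ∑ (applyUpTo f n) g ≡ ∑< n (g ∘ f)
  ∑-applyUpTo f zero    g = refl
  ∑-applyUpTo f (suc n) g = cong (g (f 0) ∙_) (∑-applyUpTo (f ∘ suc) n g)

  ∑<-cong : ∀ n {g h : ℕ → A} → (∀ i → i < n → g i ≡ h i) → ∑< n g ≡ ∑< n h
  ∑<-cong zero    g≗h = refl
  ∑<-cong (suc n) g≗h = cong₂ _∙_ (g≗h 0 z<s) (∑<-cong n (λ i i<n → g≗h (suc i) (s≤s i<n)))

  ∑<-∙ : ∀ n (f g : ℕ → A) → ∑< n (λ i → f i ∙ g i) ≡ ∑< n f ∙ ∑< n g
  ∑<-∙ zero    f g = sym (identityˡ ε)
  ∑<-∙ (suc n) f g = trans (cong ((f 0 ∙ g 0) ∙_) (∑<-∙ n (f ∘ suc) (g ∘ suc)))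
                           (interchange (f 0) (g 0) (∑< n (f ∘ suc)) (∑< n (g ∘ suc)))

  ∑<-ε : ∀ n {g : ℕ → A} → (∀ i → i < n → g i ≡ ε) → ∑< n g ≡ ε
  ∑<-ε zero    g≗ε = refl
  ∑<-ε (suc n) g≗ε = trans (cong₂ _∙_ (g≗ε 0 z<s) (∑<-ε n (λ i i<n → g≗ε (suc i) (s≤s i<n)))) (identityˡ ε)

  ∑<-∑-comm : ∀ n (xs : List X) (g : ℕ → X → A) → ∑< n (λ i → ∑ xs (g i)) ≡ ∑ xs (λ a → ∑< n (λ i → g i a))
  ∑<-∑-comm zero    xs g = sym (∑-ε xs (λ _ → refl))
  ∑<-∑-comm (suc n) xs g = trans (cong (∑ xs (g 0) ∙_) (∑<-∑-comm n xs (g ∘ suc))) (sym (∑-∙ xs (g 0) _))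

  ∑<-comm : ∀ n m (g : ℕ → ℕ → A) → ∑< n (λ i → ∑< m (g i)) ≡ ∑< m (λ j → ∑< n (λ i → g i j))
  ∑<-comm zero    m g = sym (∑<-ε m (λ _ _ → refl))
  ∑<-comm (suc n) m g = trans (cong (∑< m (g 0) ∙_) (∑<-comm n m (g ∘ suc))) (sym (∑<-∙ m (g 0) _))

  ∑<-vanishing-tail : ∀ {m n} {g : ℕ → A} → m ≤ n → (∀ i → m ≤ i → g i ≡ ε) → ∑< n g ≡ ∑< m g
  ∑<-vanishing-tail {n = n} z≤n       g≗ε = ∑<-ε n (λ i _ → g≗ε i z≤n)
  ∑<-vanishing-tail {g = g} (s≤s m≤n) g≗ε =
    cong (g 0 ∙_) (∑<-vanishing-tail m≤n (λ i m≤i → g≗ε (suc i) (s≤s m≤i)))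

  ∑<-vanishing-tails : ∀ m n {g : ℕ → A} → (∀ i → m ≤ i → g i ≡ ε) → (∀ i → n ≤ i → g i ≡ ε) →
                       ∑< m g ≡ ∑< n g
  ∑<-vanishing-tails m n g≗ε₁ g≗ε₂ =
    [ (λ m≤n → sym (∑<-vanishing-tail m≤n g≗ε₁)) , (λ n≤m → ∑<-vanishing-tail n≤m g≗ε₂) ]′ (ℕ.≤-total m n)

  ∑<-select : ∀ {t n} (g : ℕ → A) → t < n → ∑< n (λ s → if does (t ℕ.≟ s) then g s else ε) ≡ g t
  ∑<-select {zero}  {suc n} g _         = trans (cong (g 0 ∙_) (∑<-ε n (λ _ _ → refl))) (identityʳ (g 0))
  ∑<-select {suc t} {suc n} g (s≤s t<n) = trans (identityˡ _) (∑<-select (g ∘ suc) t<n)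

  ∑<-select-none : ∀ {t n} (g : ℕ → A) → n ≤ t → ∑< n (λ s → if does (t ℕ.≟ s) then g s else ε) ≡ ε
  ∑<-select-none {t} {n} g n≤t =
    ∑<-ε n (λ s s<n → cong (if_then g s else ε) (dec-false (t ℕ.≟ s) (ℕ.>⇒≢ (ℕ.<-≤-trans s<n n≤t))))

  ∑-allFin-toℕ-select : ∀ {t n} (g : ℕ → A) → t < n →
                        ∑ (allFin n) (λ i → if does (t ℕ.≟ toℕ i) then g (toℕ i) else ε) ≡ g t
  ∑-allFin-toℕ-select {t} {n} g t<n =
    trans (∑-allFin-toℕ n (λ s → if does (t ℕ.≟ s) then g s else ε)) (∑<-select g t<n)

  ∑-allFin-toℕ-select-none : ∀ {t n} (g : ℕ → A) → n ≤ t →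
                             ∑ (allFin n) (λ i → if does (t ℕ.≟ toℕ i) then g (toℕ i) else ε) ≡ ε
  ∑-allFin-toℕ-select-none {t} {n} g n≤t =
    trans (∑-allFin-toℕ n (λ s → if does (t ℕ.≟ s) then g s else ε)) (∑<-select-none g n≤t)

  ∑-allFin-select : ∀ {n} (i : Fin n) (g : Fin n → A) →
                    ∑ (allFin n) (λ j → if does (i Fin.≟ j) then g j else ε) ≡ g i
  ∑-allFin-select {suc n} Fin.zero    g =
    trans (∑-allFin-suc n _) (trans (cong (g Fin.zero ∙_) (∑-ε (allFin n) (λ _ → refl))) (identityʳ (g Fin.zero)))
  ∑-allFin-select {suc n} (Fin.suc i) g =
    trans (∑-allFin-suc n _) (trans (identityˡ _) (∑-allFin-select i (g ∘ Fin.suc)))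

  -- allFuns extends functions by a pattern lambda, which agrees with j ∷ f only pointwise;
  -- hence the hypothesis that F respects pointwise equality.
  ∑-allFuns-suc : ∀ {n k} (F : (Fin (suc n) → Fin k) → A) → (∀ {f g} → f ≗ g → F f ≡ F g) →
                  ∑ (allFuns (suc n) k) F ≡ ∑ (allFuns n k) (λ f → ∑ (allFin k) (λ j → F (j Vector.∷ f)))
  ∑-allFuns-suc {n} {k} F F-cong = begin
    ∑ (allFuns (suc n) k) F
      ≡⟨ ∑-concatMap _ (allFuns n k) F ⟩
    ∑ (allFuns n k) (λ f → ∑ (map _ (allFin k)) F)
      ≡⟨ ∑-cong (allFuns n k) (λ f → ∑-map _ (allFin k) F) ⟩
    ∑ (allFuns n k) (λ f → ∑ (allFin k) (λ j → F _))
      ≡⟨ ∑-cong (allFuns n k) (λ f → ∑-cong (allFin k) (λ j → F-cong λ { Fin.zero → refl ; (Fin.suc i) → refl })) ⟩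
    ∑ (allFuns n k) (λ f → ∑ (allFin k) (λ j → F (j Vector.∷ f)))  ∎

  ∑-allFuns-select : ∀ r m (c : Fin r → ℕ) → (∀ i → c i < m) →
                     (H : (Fin r → ℕ) → A) → (∀ {α β} → α ≗ β → H α ≡ H β) →
                     ∑ (allFuns r m) (λ g → if does (all? (λ i → c i ℕ.≟ toℕ (g i))) then H (toℕ ∘ g) else ε) ≡ H c
  ∑-allFuns-select zero    m c c<m H H-cong = trans (identityʳ _) (H-cong (λ ()))
  ∑-allFuns-select (suc r) m c c<m H H-cong = begin
    ∑ (allFuns (suc r) m) F
      ≡⟨ ∑-allFuns-suc F F-cong ⟩
    ∑ (allFuns r m) (λ g → ∑ (allFin m) (λ j → F (j Vector.∷ g)))
      ≡⟨ ∑-cong (allFuns r m) (λ g → ∑-cong (allFin m) (λ j → F-∷ j g)) ⟩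
    ∑ (allFuns r m) (λ g → ∑ (allFin m) (λ j → if does (c Fin.zero ℕ.≟ toℕ j) then Rest g (toℕ j) else ε))
      ≡⟨ ∑-cong (allFuns r m) (λ g → ∑-allFin-toℕ-select (Rest g) (c<m Fin.zero)) ⟩
    ∑ (allFuns r m) (λ g → Rest g (c Fin.zero))
      ≡⟨ ∑-allFuns-select r m (c ∘ Fin.suc) (c<m ∘ Fin.suc) (λ β → H (c Fin.zero Vector.∷ β)) (H-cong ∘ ∷-cong) ⟩
    H (c Fin.zero Vector.∷ c ∘ Fin.suc)
      ≡⟨ H-cong (λ { Fin.zero → refl ; (Fin.suc i) → refl }) ⟩
    H c  ∎
    where
    matches : ∀ {s} → (Fin s → ℕ) → (Fin s → Fin m) → Bool
    matches d g = does (all? (λ i → d i ℕ.≟ toℕ (g i)))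
    F : (Fin (suc r) → Fin m) → A
    F g = if matches c g then H (toℕ ∘ g) else ε
    Rest : (Fin r → Fin m) → ℕ → A
    Rest g t = if matches (c ∘ Fin.suc) g then H (t Vector.∷ toℕ ∘ g) else ε
    ∷-cong : ∀ {t} {α β : Fin r → ℕ} → α ≗ β → (t Vector.∷ α) ≗ (t Vector.∷ β)
    ∷-cong α≗β Fin.zero    = refl
    ∷-cong α≗β (Fin.suc i) = α≗β i
    matches-cong : ∀ {g g′} → g ≗ g′ → matches c g ≡ matches c g′
    matches-cong {g} {g′} g≗g′ =
      does-≡ (all? (λ i → c i ℕ.≟ toℕ (g i)))
             (map′ (λ eq i → trans (eq i) (cong toℕ (sym (g≗g′ i))))
                   (λ eq i → trans (eq i) (cong toℕ (g≗g′ i)))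
                   (all? (λ i → c i ℕ.≟ toℕ (g′ i))))
    F-cong : ∀ {g g′} → g ≗ g′ → F g ≡ F g′
    F-cong g≗g′ = cong₂ (if_then_else ε) (matches-cong g≗g′) (H-cong (cong toℕ ∘ g≗g′))
    F-∷ : ∀ j g → F (j Vector.∷ g) ≡ (if does (c Fin.zero ℕ.≟ toℕ j) then Rest g (toℕ j) else ε)
    F-∷ j g = trans (if-cong-then (matches c (j Vector.∷ g)) (H-cong (λ { Fin.zero → refl ; (Fin.suc i) → refl })))
                    (if-∧ (does (c Fin.zero ℕ.≟ toℕ j)))

  weight-cong : ∀ {r} {α β : Fin r → ℕ} → α ≗ β → weight α ≡ weight β
  weight-cong {r} α≗β = cong (foldr ℕ._+_ 0) (map-cong (λ i → cong (suc (toℕ i) ℕ.*_) (α≗β i)) (allFin r))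

  ∑-compositionsVec-select : ∀ r n (c : Fin r → ℕ) → (∀ i → c i ≤ n) →
                             (h : (Fin r → ℕ) → A) → (∀ {α β} → α ≗ β → h α ≡ h β) →
                             ∑ (compositionsVec r n) (λ α → if does (all? (λ i → c i ℕ.≟ α i)) then h α else ε)
                               ≡ (if does (weight c ℕ.≟ n) then h c else ε)
  ∑-compositionsVec-select r n c c≤n h h-cong = begin
    ∑ (filter (λ α → weight α ℕ.≟ n) (map toℕ∘ (allFuns r (suc n)))) (λ α → if matches α then h α else ε)
      ≡⟨ ∑-filter (λ α → weight α ℕ.≟ n) (map toℕ∘ (allFuns r (suc n))) _ ⟩
    ∑ (map toℕ∘ (allFuns r (suc n))) (λ α → if does (weight α ℕ.≟ n) then (if matches α then h α else ε) else ε)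
      ≡⟨ ∑-map toℕ∘ (allFuns r (suc n)) _ ⟩
    ∑ (allFuns r (suc n)) (λ g → if does (weight (toℕ∘ g) ℕ.≟ n) then (if matches (toℕ∘ g) then h (toℕ∘ g) else ε) else ε)
      ≡⟨ ∑-cong (allFuns r (suc n)) (λ g → if-swap-then (does (weight (toℕ∘ g) ℕ.≟ n)) (matches (toℕ∘ g))) ⟩
    ∑ (allFuns r (suc n)) (λ g → if matches (toℕ∘ g) then H (toℕ∘ g) else ε)
      ≡⟨ ∑-allFuns-select r (suc n) c (s≤s ∘ c≤n) H H-cong ⟩
    H c  ∎
    where
    toℕ∘ : (Fin r → Fin (suc n)) → Fin r → ℕ
    toℕ∘ g i = toℕ (g i)
    matches : (Fin r → ℕ) → Bool
    matches α = does (all? (λ i → c i ℕ.≟ α i))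
    H : (Fin r → ℕ) → A
    H α = if does (weight α ℕ.≟ n) then h α else ε
    H-cong : ∀ {α β} → α ≗ β → H α ≡ H β
    H-cong α≗β = cong₂ (λ w v → if does (w ℕ.≟ n) then v else ε) (weight-cong α≗β) (h-cong α≗β)

module BigOperatorHomomorphism
  {A B : Set} {_∙_ : Op₂ A} {ε : A} {_◦_ : Op₂ B} {ε′ : B}
  (M : IsCommutativeMonoid _≡_ _∙_ ε) (N : IsCommutativeMonoid _≡_ _◦_ ε′)
  (h : A → B) (h-ε : h ε ≡ ε′) (h-∙ : ∀ a b → h (a ∙ b) ≡ h a ◦ h b) where

  private
    module M = BigOperators M
    module N = BigOperators N

  ∑-homo : {X : Set} (xs : List X) (f : X → A) → h (M.∑ xs f) ≡ N.∑ xs (h ∘ f)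
  ∑-homo []       f = h-ε
  ∑-homo (x ∷ xs) f = trans (h-∙ (f x) (M.∑ xs f)) (cong (h (f x) ◦_) (∑-homo xs f))

  ∑<-homo : ∀ n (g : ℕ → A) → h (M.∑< n g) ≡ N.∑< n (h ∘ g)
  ∑<-homo zero    g = h-ε
  ∑<-homo (suc n) g = trans (h-∙ (g 0) (M.∑< n (g ∘ suc))) (cong (h (g 0) ◦_) (∑<-homo n (g ∘ suc)))

module ℚ+ = BigOperators ℚ.+-0-isCommutativeMonoid
module ℚ* = BigOperators ℚ.*-1-isCommutativeMonoid
module ℕ+ = BigOperators ℕ.+-0-isCommutativeMonoid

module Counting {A : Set} {_∙_ : Op₂ A} {ε : A} (isCM : IsCommutativeMonoid _≡_ _∙_ ε) where

  open BigOperators isCM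

  ∑-count : {I J : Set} (is : List I) (js : List J) (h : I → ℕ → A) (g : I → A) →
            (∀ i → h i 0 ≡ ε) → (∀ i a b → h i (a ℕ.+ b) ≡ h i a ∙ h i b) → (∀ i → h i 1 ≡ g i) →
            {P : I → J → Set} (P? : ∀ i j → Dec (P i j)) →
            ∑ is (λ i → h i (length (filter (P? i) js))) ≡ ∑ js (λ j → ∑ is (λ i → if does (P? i j) then g i else ε))
  ∑-count is js h g h-0 h-+ h-1 P? = begin
    ∑ is (λ i → h i (length (filter (P? i) js)))
      ≡⟨ ∑-cong is (λ i → cong (h i) (ℕ+.∑-filter (P? i) js (λ _ → 1))) ⟩
    ∑ is (λ i → h i (ℕ+.∑ js (λ j → if does (P? i j) then 1 else 0)))
      ≡⟨ ∑-cong is (λ i → BigOperatorHomomorphism.∑-homo ℕ.+-0-isCommutativeMonoid isCM (h i) (h-0 i) (h-+ i) js _) ⟩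
    ∑ is (λ i → ∑ js (λ j → h i (if does (P? i j) then 1 else 0)))
      ≡⟨ ∑-cong is (λ i → ∑-cong js (λ j → trans (if-float (h i) (does (P? i j)))
                                                  (cong₂ (if does (P? i j) then_else_) (h-1 i) (h-0 i)))) ⟩
    ∑ is (λ i → ∑ js (λ j → if does (P? i j) then g i else ε))
      ≡⟨ ∑-comm is js _ ⟩
    ∑ js (λ j → ∑ is (λ i → if does (P? i j) then g i else ε))  ∎
    where open ≡-Reasoning

∑-mono-≤ : {X : Set} (xs : List X) {g h : X → ℕ} → (∀ a → g a ≤ h a) → ℕ+.∑ xs g ≤ ℕ+.∑ xs h
∑-mono-≤ []       g≤h = z≤n
∑-mono-≤ (x ∷ xs) g≤h = ℕ.+-mono-≤ (g≤h x) (∑-mono-≤ xs g≤h)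

∑-mono-< : {X : Set} {xs : List X} {g h : X → ℕ} → (∀ a → g a ≤ h a) →
           ∀ {x} → x ∈ xs → g x < h x → ℕ+.∑ xs g < ℕ+.∑ xs h
∑-mono-< {xs = _ ∷ xs} g≤h (here refl)  gx<hx = ℕ.+-mono-<-≤ gx<hx (∑-mono-≤ xs g≤h)
∑-mono-< {xs = y ∷ _}  g≤h (there x∈xs) gx<hx = ℕ.+-mono-≤-< (g≤h y) (∑-mono-< g≤h x∈xs gx<hx)

toℚ≡mkℚ : ∀ m → toℚ m ≡ mkℚ (+ m) 0 (Coprime.sym (1-coprimeTo m))
toℚ≡mkℚ m = ℚ.↥p/↧p≡p (mkℚ (+ m) 0 _)

toℚ-+ : ∀ m n → toℚ (m ℕ.+ n) ≡ toℚ m ℚ.+ toℚ n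
toℚ-+ m n = begin
  + (m ℕ.+ n) / 1                        ≡⟨ cong₂ (λ a b → (a ℤ.+ b) / 1) (ℤ.*-identityʳ (+ m)) (ℤ.*-identityʳ (+ n)) ⟨
  (+ m ℤ.* + 1 ℤ.+ + n ℤ.* + 1) / 1      ≡⟨ cong₂ ℚ._+_ (toℚ≡mkℚ m) (toℚ≡mkℚ n) ⟨
  toℚ m ℚ.+ toℚ n                        ∎
  where open ≡-Reasoning

toℚ-* : ∀ m n → toℚ (m ℕ.* n) ≡ toℚ m ℚ.* toℚ n
toℚ-* m n = begin
  + (m ℕ.* n) / 1     ≡⟨ cong (_/ 1) (ℤ.pos-* m n) ⟩
  (+ m ℤ.* + n) / 1   ≡⟨ cong₂ ℚ._*_ (toℚ≡mkℚ m) (toℚ≡mkℚ n) ⟨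
  toℚ m ℚ.* toℚ n     ∎
  where open ≡-Reasoning

toℚ-∑ : {X : Set} (xs : List X) (f : X → ℕ) → toℚ (ℕ+.∑ xs f) ≡ Σℚ xs (toℚ ∘ f)
toℚ-∑ = BigOperatorHomomorphism.∑-homo ℕ.+-0-isCommutativeMonoid ℚ.+-0-isCommutativeMonoid toℚ refl toℚ-+

invFact*k!≡1 : ∀ k → invFact k ℚ.* toℚ (k !) ≡ 1ℚ
invFact*k!≡1 k = 1/n*n≡1 (k !) {{k !≢0}}
  where
  1/n*n≡1 : ∀ n .{{_ : ℕ.NonZero n}} → (+ 1 / n) ℚ.* toℚ n ≡ 1ℚ
  1/n*n≡1 (suc n) = trans (cong₂ ℚ._*_ (ℚ.↥p/↧p≡p (ℚ.1/ p)) (toℚ≡mkℚ (suc n))) (ℚ.*-inverseˡ p)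
    where
    p : ℚ
    p = mkℚ (+ suc n) 0 (Coprime.sym (1-coprimeTo (suc n)))

powℚ-+ : ∀ q a b → powℚ q (a ℕ.+ b) ≡ powℚ q a ℚ.* powℚ q b
powℚ-+ q zero    b = sym (ℚ.*-identityˡ (powℚ q b))
powℚ-+ q (suc a) b = trans (cong (q ℚ.*_) (powℚ-+ q a b)) (sym (ℚ.*-assoc q (powℚ q a) (powℚ q b)))

*-distribˡ-Σℚ : (c : ℚ) {X : Set} (xs : List X) (f : X → ℚ) → c ℚ.* Σℚ xs f ≡ Σℚ xs (λ a → c ℚ.* f a)
*-distribˡ-Σℚ c = BigOperatorHomomorphism.∑-homo ℚ.+-0-isCommutativeMonoid ℚ.+-0-isCommutativeMonoid
                    (c ℚ.*_) (ℚ.*-zeroʳ c) (ℚ.*-distribˡ-+ c)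

*-distribˡ-Σℚ< : (c : ℚ) (n : ℕ) (g : ℕ → ℚ) → c ℚ.* ℚ+.∑< n g ≡ ℚ+.∑< n (λ i → c ℚ.* g i)
*-distribˡ-Σℚ< c = BigOperatorHomomorphism.∑<-homo ℚ.+-0-isCommutativeMonoid ℚ.+-0-isCommutativeMonoid
                     (c ℚ.*_) (ℚ.*-zeroʳ c) (ℚ.*-distribˡ-+ c)

zero-*-* : ∀ {a} b c → a ≡ 0ℚ → a ℚ.* b ℚ.* c ≡ 0ℚ
zero-*-* b c refl = trans (cong (ℚ._* c) (ℚ.*-zeroˡ b)) (ℚ.*-zeroˡ c)

*-zero-* : ∀ a {b} c → b ≡ 0ℚ → a ℚ.* b ℚ.* c ≡ 0ℚ
*-zero-* a c refl = trans (cong (ℚ._* c) (ℚ.*-zeroʳ a)) (ℚ.*-zeroˡ c)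

*-*-zero : ∀ a b {c} → c ≡ 0ℚ → a ℚ.* b ℚ.* c ≡ 0ℚ
*-*-zero a b refl = ℚ.*-zeroʳ (a ℚ.* b)

δ₀ : ℕ → ℚ
δ₀ zero    = 1ℚ
δ₀ (suc _) = 0ℚ

infixl 7 _⋆_

_⋆_ : (ℕ → ℚ) → (ℕ → ℚ) → ℕ → ℚ
(a ⋆ b) n = ℚ+.∑< (suc n) (λ i → toℚ (n C i) ℚ.* a i ℚ.* b (n ∸ i))

⋆-congʳ : ∀ a {b b′} n → (∀ m → m ≤ n → b m ≡ b′ m) → (a ⋆ b) n ≡ (a ⋆ b′) n
⋆-congʳ a n b≗b′ = ℚ+.∑<-cong (suc n) (λ i _ → cong (toℚ (n C i) ℚ.* a i ℚ.*_) (b≗b′ (n ∸ i) (ℕ.m∸n≤m n i)))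

⋆-suc : ∀ a b m → a 0 ≡ 0ℚ →
        (a ⋆ b) (suc m) ≡ ℚ+.∑< (suc m) (λ j → toℚ (suc m C suc j) ℚ.* a (suc j) ℚ.* b (m ∸ j))
⋆-suc a b m a₀≡0 =
  trans (cong (ℚ._+ ℚ+.∑< (suc m) tail) (*-zero-* 1ℚ (b (suc m)) a₀≡0)) (ℚ.+-identityˡ (ℚ+.∑< (suc m) tail))
  where
  tail : ℕ → ℚ
  tail j = toℚ (suc m C suc j) ℚ.* a (suc j) ℚ.* b (m ∸ j)

⋆-distribˡ-Σℚ : ∀ a {X : Set} (xs : List X) (b : X → ℕ → ℚ) n →
                (a ⋆ (λ m → Σℚ xs (λ x → b x m))) n ≡ Σℚ xs (λ x → (a ⋆ b x) n)
⋆-distribˡ-Σℚ a xs b n = begin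
  ℚ+.∑< (suc n) (λ i → c i ℚ.* Σℚ xs (λ x → b x (n ∸ i)))
    ≡⟨ ℚ+.∑<-cong (suc n) (λ i _ → *-distribˡ-Σℚ (c i) xs (λ x → b x (n ∸ i))) ⟩
  ℚ+.∑< (suc n) (λ i → Σℚ xs (λ x → c i ℚ.* b x (n ∸ i)))
    ≡⟨ ℚ+.∑<-∑-comm (suc n) xs (λ i x → c i ℚ.* b x (n ∸ i)) ⟩
  Σℚ xs (λ x → (a ⋆ b x) n)  ∎
  where
  open ≡-Reasoning
  c : ℕ → ℚ
  c i = toℚ (n C i) ℚ.* a i

⋆-leibniz : ∀ a b n → (a ⋆ b) (suc n) ≡ ((a ∘ suc) ⋆ b) n ℚ.+ (a ⋆ (b ∘ suc)) n
⋆-leibniz a b n = begin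
  first ℚ.+ ℚ+.∑< (suc n) (λ i → toℚ (suc n C suc i) ℚ.* a (suc i) ℚ.* b (n ∸ i))
    ≡⟨ cong (first ℚ.+_) (trans (ℚ+.∑<-cong (suc n) (λ i _ → pascal i)) (ℚ+.∑<-∙ (suc n) P Q)) ⟩
  first ℚ.+ (ℚ+.∑< (suc n) P ℚ.+ ℚ+.∑< (suc n) Q)
    ≡⟨ x∙yz≈y∙xz first (ℚ+.∑< (suc n) P) (ℚ+.∑< (suc n) Q) ⟩
  ℚ+.∑< (suc n) P ℚ.+ (first ℚ.+ ℚ+.∑< (suc n) Q)
    ≡⟨ cong (λ z → ℚ+.∑< (suc n) P ℚ.+ (first ℚ.+ z))
            (trans (ℚ+.∑<-vanishing-tail (ℕ.n≤1+n n) Q-tail) (ℚ+.∑<-cong n Q-shift)) ⟩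
  ((a ∘ suc) ⋆ b) n ℚ.+ (a ⋆ (b ∘ suc)) n  ∎
  where
  open ≡-Reasoning
  open import Algebra.Properties.CommutativeSemigroup
    (CommutativeMonoid.commutativeSemigroup ℚ.+-0-commutativeMonoid) using (x∙yz≈y∙xz)
  first : ℚ
  first = 1ℚ ℚ.* a 0 ℚ.* b (suc n)
  P Q : ℕ → ℚ
  P i = toℚ (n C i) ℚ.* a (suc i) ℚ.* b (n ∸ i)
  Q i = toℚ (n C suc i) ℚ.* a (suc i) ℚ.* b (n ∸ i)
  pascal : ∀ i → toℚ (suc n C suc i) ℚ.* a (suc i) ℚ.* b (n ∸ i) ≡ P i ℚ.+ Q i
  pascal i = begin
    toℚ (suc n C suc i) ℚ.* a (suc i) ℚ.* b (n ∸ i)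
      ≡⟨ cong (λ c → toℚ c ℚ.* a (suc i) ℚ.* b (n ∸ i)) (nCk+nC[k+1]≡[n+1]C[k+1] n i) ⟨
    toℚ (n C i ℕ.+ n C suc i) ℚ.* a (suc i) ℚ.* b (n ∸ i)
      ≡⟨ cong (λ c → c ℚ.* a (suc i) ℚ.* b (n ∸ i)) (toℚ-+ (n C i) (n C suc i)) ⟩
    (toℚ (n C i) ℚ.+ toℚ (n C suc i)) ℚ.* a (suc i) ℚ.* b (n ∸ i)
      ≡⟨ cong (ℚ._* b (n ∸ i)) (ℚ.*-distribʳ-+ (a (suc i)) (toℚ (n C i)) (toℚ (n C suc i))) ⟩
    (toℚ (n C i) ℚ.* a (suc i) ℚ.+ toℚ (n C suc i) ℚ.* a (suc i)) ℚ.* b (n ∸ i)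
      ≡⟨ ℚ.*-distribʳ-+ (b (n ∸ i)) (toℚ (n C i) ℚ.* a (suc i)) (toℚ (n C suc i) ℚ.* a (suc i)) ⟩
    P i ℚ.+ Q i  ∎
  Q-tail : ∀ i → n ≤ i → Q i ≡ 0ℚ
  Q-tail i n≤i = zero-*-* (a (suc i)) (b (n ∸ i)) (cong toℚ (k>n⇒nCk≡0 (s≤s n≤i)))
  Q-shift : ∀ i → i < n → Q i ≡ toℚ (n C suc i) ℚ.* a (suc i) ℚ.* b (suc (n ∸ suc i))
  Q-shift i i<n = cong (λ m → toℚ (n C suc i) ℚ.* a (suc i) ℚ.* b m) (ℕ.+-∸-assoc 1 i<n)

∏⋆ : ∀ {k} → (Fin k → ℕ → ℚ) → ℕ → ℚ
∏⋆ {zero}  as = δ₀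
∏⋆ {suc k} as = as Fin.zero ⋆ ∏⋆ (as ∘ Fin.suc)

shiftAt : ∀ {k} → Fin k → (Fin k → ℕ → ℚ) → Fin k → ℕ → ℚ
shiftAt j as j′ s = as j′ (if does (j Fin.≟ j′) then suc s else s)

∏⋆-zero : ∀ {k} (as : Fin k → ℕ → ℚ) → ∏⋆ as 0 ≡ Πℚ (allFin k) (λ j → as j 0)
∏⋆-zero {zero}  as = refl
∏⋆-zero {suc k} as = begin
  1ℚ ℚ.* as Fin.zero 0 ℚ.* ∏⋆ (as ∘ Fin.suc) 0 ℚ.+ 0ℚ
    ≡⟨ ℚ.+-identityʳ _ ⟩
  1ℚ ℚ.* as Fin.zero 0 ℚ.* ∏⋆ (as ∘ Fin.suc) 0
    ≡⟨ cong₂ ℚ._*_ (ℚ.*-identityˡ (as Fin.zero 0)) (∏⋆-zero (as ∘ Fin.suc)) ⟩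
  as Fin.zero 0 ℚ.* Πℚ (allFin k) (λ j → as (Fin.suc j) 0)
    ≡⟨ ℚ*.∑-allFin-suc k (λ j → as j 0) ⟨
  Πℚ (allFin (suc k)) (λ j → as j 0)  ∎
  where open ≡-Reasoning

∏⋆-suc : ∀ {k} (as : Fin k → ℕ → ℚ) n → ∏⋆ as (suc n) ≡ Σℚ (allFin k) (λ j → ∏⋆ (shiftAt j as) n)
∏⋆-suc {zero}  as n = refl
∏⋆-suc {suc k} as n = begin
  (a ⋆ ∏⋆ (as ∘ Fin.suc)) (suc n)
    ≡⟨ ⋆-leibniz a (∏⋆ (as ∘ Fin.suc)) n ⟩
  ((a ∘ suc) ⋆ ∏⋆ (as ∘ Fin.suc)) n ℚ.+ (a ⋆ (∏⋆ (as ∘ Fin.suc) ∘ suc)) n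
    ≡⟨ cong (((a ∘ suc) ⋆ ∏⋆ (as ∘ Fin.suc)) n ℚ.+_) (⋆-congʳ a n (λ m _ → ∏⋆-suc (as ∘ Fin.suc) m)) ⟩
  ((a ∘ suc) ⋆ ∏⋆ (as ∘ Fin.suc)) n ℚ.+ (a ⋆ (λ m → Σℚ (allFin k) (λ j → ∏⋆ (shiftAt j (as ∘ Fin.suc)) m))) n
    ≡⟨ cong (((a ∘ suc) ⋆ ∏⋆ (as ∘ Fin.suc)) n ℚ.+_)
            (⋆-distribˡ-Σℚ a (allFin k) (λ j → ∏⋆ (shiftAt j (as ∘ Fin.suc))) n) ⟩
  ∏⋆ (shiftAt Fin.zero as) n ℚ.+ Σℚ (allFin k) (λ j → ∏⋆ (shiftAt (Fin.suc j) as) n)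
    ≡⟨ ℚ+.∑-allFin-suc k (λ j → ∏⋆ (shiftAt j as) n) ⟨
  Σℚ (allFin (suc k)) (λ j → ∏⋆ (shiftAt j as) n)  ∎
  where
  open ≡-Reasoning
  a : ℕ → ℚ
  a = as Fin.zero

∏⋆-vanishes : ∀ {k} (as : Fin k → ℕ → ℚ) → (∀ j → as j 0 ≡ 0ℚ) → ∀ {n} → n < k → ∏⋆ as n ≡ 0ℚ
∏⋆-vanishes {suc k} as as₀≡0 {n} (s≤s n≤k) = ℚ+.∑<-ε (suc n) term≡0
  where
  term≡0 : ∀ i → i < suc n → toℚ (n C i) ℚ.* as Fin.zero i ℚ.* ∏⋆ (as ∘ Fin.suc) (n ∸ i) ≡ 0ℚ
  term≡0 zero    _         = *-zero-* (toℚ (n C 0)) (∏⋆ (as ∘ Fin.suc) n) (as₀≡0 Fin.zero)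
  term≡0 (suc i) (s≤s i<n) = *-*-zero (toℚ (n C suc i)) (as Fin.zero (suc i))
    (∏⋆-vanishes (as ∘ Fin.suc) (as₀≡0 ∘ Fin.suc) (ℕ.<-≤-trans (ℕ.∸-monoʳ-< {n} {suc i} {0} z<s i<n) n≤k))

infixr 8 _⋆^_

_⋆^_ : (ℕ → ℚ) → ℕ → ℕ → ℚ
φ ⋆^ k = ∏⋆ {k} (λ _ → φ)

-- The omitted terms k > n of Σ_k φ^{⋆k}(n) vanish as soon as φ(0) = 0.
⋆-geometric : (ℕ → ℚ) → ℕ → ℚ
⋆-geometric φ n = ℚ+.∑< (suc n) (λ k → (φ ⋆^ k) n)

record RenewalSolution (φ a : ℕ → ℚ) : Set where
  field
    initial : a 0 ≡ 1ℚ
    step    : ∀ m → a (suc m) ≡ (φ ⋆ a) (suc m)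

renewal-unique : ∀ φ {a b : ℕ → ℚ} → φ 0 ≡ 0ℚ → RenewalSolution φ a → RenewalSolution φ b →
                 ∀ n → a n ≡ b n
renewal-unique φ {a} {b} φ₀≡0 sa sb = <-rec (λ n → a n ≡ b n) induct
  where
  open RenewalSolution
  induct : ∀ n → (∀ {m} → m < n → a m ≡ b m) → a n ≡ b n
  induct zero    _   = trans (initial sa) (sym (initial sb))
  induct (suc m) a≡b = begin
    a (suc m)
      ≡⟨ trans (step sa m) (⋆-suc φ a m φ₀≡0) ⟩
    ℚ+.∑< (suc m) (λ j → toℚ (suc m C suc j) ℚ.* φ (suc j) ℚ.* a (m ∸ j))
      ≡⟨ ℚ+.∑<-cong (suc m) (λ j _ → cong (toℚ (suc m C suc j) ℚ.* φ (suc j) ℚ.*_) (a≡b (s≤s (ℕ.m∸n≤m m j)))) ⟩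
    ℚ+.∑< (suc m) (λ j → toℚ (suc m C suc j) ℚ.* φ (suc j) ℚ.* b (m ∸ j))
      ≡⟨ trans (step sb m) (⋆-suc φ b m φ₀≡0) ⟨
    b (suc m)  ∎
    where open ≡-Reasoning

⋆-geometric-renewal : ∀ φ → φ 0 ≡ 0ℚ → RenewalSolution φ (⋆-geometric φ)
⋆-geometric-renewal φ φ₀≡0 = record { initial = ℚ.+-identityʳ 1ℚ ; step = step }
  where
  powers-vanish : ∀ {k n} → n < k → (φ ⋆^ k) n ≡ 0ℚ
  powers-vanish = ∏⋆-vanishes (λ _ → φ) (λ _ → φ₀≡0)
  step : ∀ m → ⋆-geometric φ (suc m) ≡ (φ ⋆ ⋆-geometric φ) (suc m)
  step m = begin
    0ℚ ℚ.+ ℚ+.∑< (suc m) (λ k → (φ ⋆ φ ⋆^ k) (suc m))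
      ≡⟨ ℚ.+-identityˡ _ ⟩
    ℚ+.∑< (suc m) (λ k → (φ ⋆ φ ⋆^ k) (suc m))
      ≡⟨ ℚ+.∑<-cong (suc m) (λ k _ → ⋆-suc φ (φ ⋆^ k) m φ₀≡0) ⟩
    ℚ+.∑< (suc m) (λ k → ℚ+.∑< (suc m) (λ j → c j ℚ.* (φ ⋆^ k) (m ∸ j)))
      ≡⟨ ℚ+.∑<-comm (suc m) (suc m) (λ k j → c j ℚ.* (φ ⋆^ k) (m ∸ j)) ⟩
    ℚ+.∑< (suc m) (λ j → ℚ+.∑< (suc m) (λ k → c j ℚ.* (φ ⋆^ k) (m ∸ j)))
      ≡⟨ ℚ+.∑<-cong (suc m) (λ j _ → *-distribˡ-Σℚ< (c j) (suc m) (λ k → (φ ⋆^ k) (m ∸ j))) ⟨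
    ℚ+.∑< (suc m) (λ j → c j ℚ.* ℚ+.∑< (suc m) (λ k → (φ ⋆^ k) (m ∸ j)))
      ≡⟨ ℚ+.∑<-cong (suc m) (λ j _ → cong (c j ℚ.*_)
                                            (ℚ+.∑<-vanishing-tail (s≤s (ℕ.m∸n≤m m j)) (λ k → powers-vanish))) ⟩
    ℚ+.∑< (suc m) (λ j → c j ℚ.* ⋆-geometric φ (m ∸ j))
      ≡⟨ ⋆-suc φ (⋆-geometric φ) m φ₀≡0 ⟨
    (φ ⋆ ⋆-geometric φ) (suc m)  ∎
    where
    open ≡-Reasoning
    c : ℕ → ℚ
    c j = toℚ (suc m C suc j) ℚ.* φ (suc j)

nth-prevs : ∀ r (y : Fin r → ℚ) {n i} → i < n → nth (prevs r y n) i ≡ Fib r y (n ∸ suc i)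
nth-prevs r y {suc n} {zero}  _         = refl
nth-prevs r y {suc n} {suc i} (s≤s i<n) = nth-prevs r y i<n

-- `does (m <? n)` computes to `m <ᵇ n` and `does (m ≟ n)` to `m ≡ᵇ n`, the tests made by fibStep.
module _ (r′ : ℕ) (y : Fin (suc r′) → ℚ) where

  Fib-below : ∀ {n} → n < r′ → Fib (suc r′) y n ≡ 0ℚ
  Fib-below {n} n<r′ rewrite dec-true (n ℕ.<? r′) n<r′ = refl

  Fib-initial : Fib (suc r′) y r′ ≡ 1ℚ
  Fib-initial rewrite dec-false (r′ ℕ.<? r′) (ℕ.<-irrefl refl) | dec-true (r′ ℕ.≟ r′) refl = refl

  Fib-step : ∀ {n} → r′ < n →
             Fib (suc r′) y n ≡ Σℚ (allFin (suc r′)) (λ i → y i ℚ.* nth (prevs (suc r′) y n) (toℕ i))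
  Fib-step {n} r′<n rewrite dec-false (n ℕ.<? r′) (ℕ.<⇒≯ r′<n) | dec-false (n ℕ.≟ r′) (ℕ.>⇒≢ r′<n) = refl

nCk*[k!*[n∸k]!]≡n! : ∀ {n k} → k ≤ n → (n C k) ℕ.* (k ! ℕ.* (n ∸ k) !) ≡ n !
nCk*[k!*[n∸k]!]≡n! {n} {k} k≤n =
  trans (cong (ℕ._* (k ! ℕ.* (n ∸ k) !)) (nCk≡n!/k![n-k]! k≤n)) (m/n*n≡m {{k !* (n ∸ k) !≢0}} (k![n∸k]!∣n! k≤n))

m<j≤o⇒m+o∸j<o : ∀ {m j o} → m < j → j ≤ o → m ℕ.+ o ∸ j < o
m<j≤o⇒m+o∸j<o {m} {j} {o} m<j j≤o = begin-strict
  m ℕ.+ o ∸ j    ≡⟨ ℕ.+-∸-assoc m j≤o ⟩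
  m ℕ.+ (o ∸ j)  <⟨ ℕ.+-monoˡ-< (o ∸ j) m<j ⟩
  j ℕ.+ (o ∸ j)  ≡⟨ ℕ.m+[n∸m]≡n j≤o ⟩
  o              ∎
  where open ℕ.≤-Reasoning

blockWeight : (r : ℕ) → (Fin r → ℚ) → ℕ → ℚ
blockWeight r       x zero          = 0ℚ
blockWeight zero    x (suc t)       = 0ℚ
blockWeight (suc r) x (suc zero)    = x Fin.zero
blockWeight (suc r) x (suc (suc t)) = blockWeight r (x ∘ Fin.suc) (suc t)

blockWeight-suc-toℕ : ∀ r (x : Fin r → ℚ) i → blockWeight r x (suc (toℕ i)) ≡ x i
blockWeight-suc-toℕ (suc r) x Fin.zero    = refl
blockWeight-suc-toℕ (suc r) x (Fin.suc i) = blockWeight-suc-toℕ r (x ∘ Fin.suc) i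

blockWeight-beyond : ∀ r (x : Fin r → ℚ) {t} → r < t → blockWeight r x t ≡ 0ℚ
blockWeight-beyond zero    x {suc t}       _               = refl
blockWeight-beyond (suc r) x {suc (suc t)} (s≤s (s≤s r≤t)) = blockWeight-beyond r (x ∘ Fin.suc) (s≤s r≤t)

module ScaledFibonacci (r′ : ℕ) (x : Fin (suc r′) → ℚ) where

  y : Fin (suc r′) → ℚ
  y i = invFact (suc (toℕ i)) ℚ.* x i

  φ : ℕ → ℚ
  φ = blockWeight (suc r′) x

  F : ℕ → ℚ
  F = Fib (suc r′) y

  scaledFib : ℕ → ℚ
  scaledFib n = toℚ (n !) ℚ.* F (n ℕ.+ r′)

  F-step : ∀ m → F (suc (m ℕ.+ r′)) ≡
                 ℚ+.∑< (suc r′) (λ j → invFact (suc j) ℚ.* φ (suc j) ℚ.* F (m ℕ.+ r′ ∸ j))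
  F-step m = begin
    F (suc (m ℕ.+ r′))
      ≡⟨ Fib-step r′ y (s≤s (ℕ.m≤n+m r′ m)) ⟩
    Σℚ (allFin (suc r′)) (λ i → y i ℚ.* nth (prevs (suc r′) y (suc (m ℕ.+ r′))) (toℕ i))
      ≡⟨ ℚ+.∑-cong (allFin (suc r′)) (λ i → cong₂ (λ u v → invFact (suc (toℕ i)) ℚ.* u ℚ.* v)
                                                   (sym (blockWeight-suc-toℕ (suc r′) x i))
                                                   (nth-prevs (suc r′) y (s≤s (index≤ i)))) ⟩
    Σℚ (allFin (suc r′)) (λ i → invFact (suc (toℕ i)) ℚ.* φ (suc (toℕ i)) ℚ.* F (m ℕ.+ r′ ∸ toℕ i))
      ≡⟨ ℚ+.∑-allFin-toℕ (suc r′) (λ j → invFact (suc j) ℚ.* φ (suc j) ℚ.* F (m ℕ.+ r′ ∸ j)) ⟩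
    ℚ+.∑< (suc r′) (λ j → invFact (suc j) ℚ.* φ (suc j) ℚ.* F (m ℕ.+ r′ ∸ j))  ∎
    where
    open ≡-Reasoning
    index≤ : (i : Fin (suc r′)) → toℕ i ≤ m ℕ.+ r′
    index≤ i = ℕ.≤-trans (ℕ.≤-pred (toℕ<n i)) (ℕ.m≤n+m r′ m)

  F-term-vanishes : ∀ {m j} → m < j → invFact (suc j) ℚ.* φ (suc j) ℚ.* F (m ℕ.+ r′ ∸ j) ≡ 0ℚ
  F-term-vanishes {m} {j} m<j = [ index-below , weight-beyond ]′ (ℕ.≤-<-connex j r′)
    where
    index-below : j ≤ r′ → invFact (suc j) ℚ.* φ (suc j) ℚ.* F (m ℕ.+ r′ ∸ j) ≡ 0ℚ
    index-below j≤r′ = *-*-zero (invFact (suc j)) (φ (suc j)) (Fib-below r′ y (m<j≤o⇒m+o∸j<o m<j j≤r′))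
    weight-beyond : r′ < j → invFact (suc j) ℚ.* φ (suc j) ℚ.* F (m ℕ.+ r′ ∸ j) ≡ 0ℚ
    weight-beyond r′<j = *-zero-* (invFact (suc j)) (F (m ℕ.+ r′ ∸ j)) (blockWeight-beyond (suc r′) x (s≤s r′<j))

  scaled-term≡convolution-term : ∀ m j → toℚ (suc m !) ℚ.* (invFact (suc j) ℚ.* φ (suc j) ℚ.* F (m ℕ.+ r′ ∸ j))
                                       ≡ toℚ (suc m C suc j) ℚ.* φ (suc j) ℚ.* scaledFib (m ∸ j)
  scaled-term≡convolution-term m j = [ within , beyond ]′ (ℕ.≤-<-connex j m)
    where
    open ≡-Reasoning
    c : ℕ
    c = suc m C suc j
    I P : ℚ
    I = invFact (suc j)
    P = φ (suc j)
    within : j ≤ m → toℚ (suc m !) ℚ.* (I ℚ.* P ℚ.* F (m ℕ.+ r′ ∸ j)) ≡ toℚ c ℚ.* P ℚ.* scaledFib (m ∸ j)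
    within j≤m = begin
      toℚ (suc m !) ℚ.* (I ℚ.* P ℚ.* F (m ℕ.+ r′ ∸ j))
        ≡⟨ cong₂ (λ u v → toℚ u ℚ.* (I ℚ.* P ℚ.* F v)) (sym (nCk*[k!*[n∸k]!]≡n! (s≤s j≤m))) (ℕ.+-∸-comm r′ j≤m) ⟩
      toℚ (c ℕ.* (suc j ! ℕ.* (m ∸ j) !)) ℚ.* (I ℚ.* P ℚ.* F′)
        ≡⟨ cong (ℚ._* (I ℚ.* P ℚ.* F′))
                (trans (toℚ-* c (suc j ! ℕ.* (m ∸ j) !)) (cong (toℚ c ℚ.*_) (toℚ-* (suc j !) ((m ∸ j) !)))) ⟩
      toℚ c ℚ.* (toℚ (suc j !) ℚ.* toℚ ((m ∸ j) !)) ℚ.* (I ℚ.* P ℚ.* F′)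
        ≡⟨ solve 6 (λ C A B I P F → (C ⊕ (A ⊕ B)) ⊕ ((I ⊕ P) ⊕ F) ⊜ ((C ⊕ P) ⊕ (B ⊕ F)) ⊕ (I ⊕ A))
                 refl (toℚ c) (toℚ (suc j !)) (toℚ ((m ∸ j) !)) I P F′ ⟩
      toℚ c ℚ.* P ℚ.* scaledFib (m ∸ j) ℚ.* (I ℚ.* toℚ (suc j !))
        ≡⟨ cong (toℚ c ℚ.* P ℚ.* scaledFib (m ∸ j) ℚ.*_) (invFact*k!≡1 (suc j)) ⟩
      toℚ c ℚ.* P ℚ.* scaledFib (m ∸ j) ℚ.* 1ℚ
        ≡⟨ ℚ.*-identityʳ (toℚ c ℚ.* P ℚ.* scaledFib (m ∸ j)) ⟩
      toℚ c ℚ.* P ℚ.* scaledFib (m ∸ j)  ∎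
      where
      open import Algebra.Solver.CommutativeMonoid ℚ.*-1-commutativeMonoid using (solve; _⊕_; _⊜_)
      F′ : ℚ
      F′ = F (m ∸ j ℕ.+ r′)
    beyond : m < j → toℚ (suc m !) ℚ.* (I ℚ.* P ℚ.* F (m ℕ.+ r′ ∸ j)) ≡ toℚ c ℚ.* P ℚ.* scaledFib (m ∸ j)
    beyond m<j = begin
      toℚ (suc m !) ℚ.* (I ℚ.* P ℚ.* F (m ℕ.+ r′ ∸ j))  ≡⟨ cong (toℚ (suc m !) ℚ.*_) (F-term-vanishes m<j) ⟩
      toℚ (suc m !) ℚ.* 0ℚ                              ≡⟨ ℚ.*-zeroʳ (toℚ (suc m !)) ⟩
      0ℚ                                                ≡⟨ zero-*-* P (scaledFib (m ∸ j)) (cong toℚ (k>n⇒nCk≡0 (s≤s m<j))) ⟨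
      toℚ c ℚ.* P ℚ.* scaledFib (m ∸ j)                 ∎

  scaledFib-renewal : RenewalSolution φ scaledFib
  scaledFib-renewal = record { initial = trans (ℚ.*-identityˡ (F r′)) (Fib-initial r′ y) ; step = step }
    where
    step : ∀ m → scaledFib (suc m) ≡ (φ ⋆ scaledFib) (suc m)
    step m = begin
      toℚ (suc m !) ℚ.* F (suc (m ℕ.+ r′))
        ≡⟨ cong (toℚ (suc m !) ℚ.*_) (F-step m) ⟩
      toℚ (suc m !) ℚ.* ℚ+.∑< (suc r′) (λ j → invFact (suc j) ℚ.* φ (suc j) ℚ.* F (m ℕ.+ r′ ∸ j))
        ≡⟨ *-distribˡ-Σℚ< (toℚ (suc m !)) (suc r′) (λ j → invFact (suc j) ℚ.* φ (suc j) ℚ.* F (m ℕ.+ r′ ∸ j)) ⟩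
      ℚ+.∑< (suc r′) (λ j → toℚ (suc m !) ℚ.* (invFact (suc j) ℚ.* φ (suc j) ℚ.* F (m ℕ.+ r′ ∸ j)))
        ≡⟨ ℚ+.∑<-cong (suc r′) (λ j _ → scaled-term≡convolution-term m j) ⟩
      ℚ+.∑< (suc r′) U
        ≡⟨ ℚ+.∑<-vanishing-tails (suc r′) (suc m) U-beyond-r′ U-beyond-m ⟩
      ℚ+.∑< (suc m) U
        ≡⟨ ⋆-suc φ scaledFib m refl ⟨
      (φ ⋆ scaledFib) (suc m)  ∎
      where
      open ≡-Reasoning
      U : ℕ → ℚ
      U j = toℚ (suc m C suc j) ℚ.* φ (suc j) ℚ.* scaledFib (m ∸ j)
      U-beyond-r′ : ∀ j → suc r′ ≤ j → U j ≡ 0ℚ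
      U-beyond-r′ j r′<j = *-zero-* (toℚ (suc m C suc j)) (scaledFib (m ∸ j)) (blockWeight-beyond (suc r′) x (s≤s r′<j))
      U-beyond-m : ∀ j → suc m ≤ j → U j ≡ 0ℚ
      U-beyond-m j m<j = zero-*-* (φ (suc j)) (scaledFib (m ∸ j)) (cong toℚ (k>n⇒nCk≡0 (s≤s m<j)))

blockSize-count : ∀ {n k} (f : Fin n → Fin k) j →
                  blockSize f j ≡ ℕ+.∑ (allFin n) (λ i → if does (f i Fin.≟ j) then 1 else 0)
blockSize-count {n} f j = ℕ+.∑-filter (λ i → f i Fin.≟ j) (allFin n) (λ _ → 1)

blockSize-cong : ∀ {n k} {f g : Fin n → Fin k} → f ≗ g → ∀ j → blockSize f j ≡ blockSize g j
blockSize-cong {n} {k} {f} {g} f≗g j = begin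
  blockSize f j                                                ≡⟨ blockSize-count f j ⟩
  ℕ+.∑ (allFin n) (λ i → if does (f i Fin.≟ j) then 1 else 0)  ≡⟨ ℕ+.∑-cong (allFin n) (cong indicator ∘ f≗g) ⟩
  ℕ+.∑ (allFin n) (λ i → if does (g i Fin.≟ j) then 1 else 0)  ≡⟨ blockSize-count g j ⟨
  blockSize g j                                                ∎
  where
  open ≡-Reasoning
  indicator : Fin k → ℕ
  indicator y = if does (y Fin.≟ j) then 1 else 0

blockSize-∷ : ∀ {n k} (j : Fin k) (f : Fin n → Fin k) j′ →
              blockSize (j Vector.∷ f) j′ ≡ (if does (j Fin.≟ j′) then suc (blockSize f j′) else blockSize f j′)
blockSize-∷ {n} j f j′ = begin
  blockSize (j Vector.∷ f) j′
    ≡⟨ blockSize-count (j Vector.∷ f) j′ ⟩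
  ℕ+.∑ (allFin (suc n)) (λ i → if does ((j Vector.∷ f) i Fin.≟ j′) then 1 else 0)
    ≡⟨ ℕ+.∑-allFin-suc n _ ⟩
  (if does (j Fin.≟ j′) then 1 else 0) ℕ.+ ℕ+.∑ (allFin n) (λ i → if does (f i Fin.≟ j′) then 1 else 0)
    ≡⟨ cong ((if does (j Fin.≟ j′) then 1 else 0) ℕ.+_) (blockSize-count f j′) ⟨
  (if does (j Fin.≟ j′) then 1 else 0) ℕ.+ blockSize f j′
    ≡⟨ if-float (ℕ._+ blockSize f j′) (does (j Fin.≟ j′)) ⟩
  (if does (j Fin.≟ j′) then suc (blockSize f j′) else blockSize f j′)  ∎
  where open ≡-Reasoning

fibreWeight : ∀ {n k} → (Fin k → ℕ → ℚ) → (Fin n → Fin k) → ℚ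
fibreWeight {k = k} as f = Πℚ (allFin k) (λ j → as j (blockSize f j))

∑-fibreWeight≡∏⋆ : ∀ n {k} (as : Fin k → ℕ → ℚ) → Σℚ (allFuns n k) (fibreWeight as) ≡ ∏⋆ as n
∑-fibreWeight≡∏⋆ zero    as = trans (ℚ.+-identityʳ _) (sym (∏⋆-zero as))
∑-fibreWeight≡∏⋆ (suc n) {k} as = begin
  Σℚ (allFuns (suc n) k) (fibreWeight as)
    ≡⟨ ℚ+.∑-allFuns-suc {n} (fibreWeight as) (λ f≗g → ℚ*.∑-cong (allFin k) (cong (as _) ∘ blockSize-cong f≗g)) ⟩
  Σℚ (allFuns n k) (λ f → Σℚ (allFin k) (λ j → fibreWeight as (j Vector.∷ f)))
    ≡⟨ ℚ+.∑-cong (allFuns n k) (λ f → ℚ+.∑-cong (allFin k) (λ j →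
         ℚ*.∑-cong (allFin k) (λ j′ → cong (as j′) (blockSize-∷ j f j′)))) ⟩
  Σℚ (allFuns n k) (λ f → Σℚ (allFin k) (λ j → fibreWeight (shiftAt j as) f))
    ≡⟨ ℚ+.∑-comm (allFuns n k) (allFin k) (λ f j → fibreWeight (shiftAt j as) f) ⟩
  Σℚ (allFin k) (λ j → Σℚ (allFuns n k) (fibreWeight (shiftAt j as)))
    ≡⟨ ℚ+.∑-cong (allFin k) (λ j → ∑-fibreWeight≡∏⋆ n (shiftAt j as)) ⟩
  Σℚ (allFin k) (λ j → ∏⋆ (shiftAt j as) n)
    ≡⟨ ∏⋆-suc as n ⟨
  ∏⋆ as (suc n)  ∎
  where open ≡-Reasoning

monomial-cong : ∀ {r} (x : Fin r → ℚ) {α β : Fin r → ℕ} → α ≗ β → monomial x α ≡ monomial x β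
monomial-cong {r} x α≗β = ℚ*.∑-cong (allFin r) (λ i → cong (powℚ (x i)) (α≗β i))

module BlockStatistics (r : ℕ) (x : Fin r → ℚ) where

  φ : ℕ → ℚ
  φ = blockWeight r x

  weightContribution : ℕ → ℕ
  weightContribution t = ℕ+.∑ (allFin r) (λ i → if does (t ℕ.≟ suc (toℕ i)) then suc (toℕ i) else 0)

  weightContribution-within : ∀ {t} → 1 ≤ t → t ≤ r → weightContribution t ≡ t
  weightContribution-within {suc t} _ t<r = ℕ+.∑-allFin-toℕ-select suc t<r

  weightContribution-beyond : ∀ {t} → r < t → weightContribution t ≡ 0
  weightContribution-beyond {suc t} (s≤s r≤t) = ℕ+.∑-allFin-toℕ-select-none suc r≤t

  weightContribution≤ : ∀ t → weightContribution t ≤ t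
  weightContribution≤ zero    = ℕ.≤-reflexive (ℕ+.∑-ε (allFin r) (λ _ → refl))
  weightContribution≤ (suc t) =
    [ (λ t<r → ℕ.≤-reflexive (weightContribution-within (s≤s z≤n) t<r))
    , (λ r≤t → ℕ.≤-trans (ℕ.≤-reflexive (weightContribution-beyond (s≤s r≤t))) z≤n)
    ]′ (ℕ.<-≤-connex t r)

  monomialContribution : ℕ → ℚ
  monomialContribution t = Πℚ (allFin r) (λ i → if does (t ℕ.≟ suc (toℕ i)) then x i else 1ℚ)

  monomialContribution-within : ∀ {t} → 1 ≤ t → t ≤ r → monomialContribution t ≡ φ t
  monomialContribution-within {suc t} _ t<r = trans
    (ℚ*.∑-cong (allFin r) (λ i → cong (if does (t ℕ.≟ toℕ i) then_else 1ℚ) (sym (blockWeight-suc-toℕ r x i))))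
    (ℚ*.∑-allFin-toℕ-select (φ ∘ suc) t<r)

  module _ {n k : ℕ} (f : Fin n → Fin k) where

    blockType : Fin r → ℕ
    blockType i = numBlocksOfSize f (suc (toℕ i))

    blockType≤ : ∀ i → blockType i ≤ k
    blockType≤ i = ℕ.≤-trans (length-filter (λ j → blockSize f j ℕ.≟ suc (toℕ i)) (allFin k))
                             (ℕ.≤-reflexive (length-tabulate id))

    ∑-blockSize : ℕ+.∑ (allFin k) (blockSize f) ≡ n
    ∑-blockSize = begin
      ℕ+.∑ (allFin k) (blockSize f)
        ≡⟨ ℕ+.∑-cong (allFin k) (blockSize-count f) ⟩
      ℕ+.∑ (allFin k) (λ j → ℕ+.∑ (allFin n) (λ i → if does (f i Fin.≟ j) then 1 else 0))
        ≡⟨ ℕ+.∑-comm (allFin k) (allFin n) (λ j i → if does (f i Fin.≟ j) then 1 else 0) ⟩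
      ℕ+.∑ (allFin n) (λ i → ℕ+.∑ (allFin k) (λ j → if does (f i Fin.≟ j) then 1 else 0))
        ≡⟨ ℕ+.∑-cong (allFin n) (λ i → ℕ+.∑-allFin-select (f i) (λ _ → 1)) ⟩
      length (allFin n)
        ≡⟨ length-tabulate id ⟩
      n  ∎
      where open ≡-Reasoning

    weight-blockType : weight blockType ≡ ℕ+.∑ (allFin k) (λ j → weightContribution (blockSize f j))
    weight-blockType = trans (ℕ+.foldr-map≡∑ (λ i → suc (toℕ i) ℕ.* blockType i) (allFin r))
      (Counting.∑-count ℕ.+-0-isCommutativeMonoid (allFin r) (allFin k) (λ i m → suc (toℕ i) ℕ.* m) (suc ∘ toℕ)
                        (λ i → ℕ.*-zeroʳ (suc (toℕ i))) (λ i → ℕ.*-distribˡ-+ (suc (toℕ i))) (λ i → ℕ.*-identityʳ (suc (toℕ i)))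
                        (λ i j → blockSize f j ℕ.≟ suc (toℕ i)))

    monomial-blockType : monomial x blockType ≡ Πℚ (allFin k) (λ j → monomialContribution (blockSize f j))
    monomial-blockType =
      Counting.∑-count ℚ.*-1-isCommutativeMonoid (allFin r) (allFin k) (λ i m → powℚ (x i) m) x
                       (λ i → refl) (λ i → powℚ-+ (x i)) (λ i → ℚ.*-identityʳ (x i))
                       (λ i j → blockSize f j ℕ.≟ suc (toℕ i))

    fibreWeight-vanishes : ∀ j → φ (blockSize f j) ≡ 0ℚ → fibreWeight (λ _ → φ) f ≡ 0ℚ
    fibreWeight-vanishes j = ℚ*.∑-absorbing ℚ.*-zeroˡ ℚ.*-zeroʳ (λ j → φ (blockSize f j)) (∈-allFin j)

    surjective-of-type≡fibreWeight : (surj? : Dec (∀ j → 1 ≤ blockSize f j)) →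
      (if does surj? then (if does (weight blockType ℕ.≟ n) then monomial x blockType else 0ℚ) else 0ℚ)
        ≡ fibreWeight (λ _ → φ) f
    surjective-of-type≡fibreWeight (no ¬surj) =
      let (j , 1≰bj) = ¬∀⟶∃¬ k _ (λ j → 1 ℕ.≤? blockSize f j) ¬surj
      in sym (fibreWeight-vanishes j (cong φ (ℕ.n<1⇒n≡0 (ℕ.≰⇒> 1≰bj))))
    surjective-of-type≡fibreWeight (yes surj) = bounded (all? (λ j → blockSize f j ℕ.≤? r))
      where
      bounded : Dec (∀ j → blockSize f j ≤ r) →
                (if does (weight blockType ℕ.≟ n) then monomial x blockType else 0ℚ) ≡ fibreWeight (λ _ → φ) f
      bounded (yes b≤r) = begin
        (if does (weight blockType ℕ.≟ n) then monomial x blockType else 0ℚ)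
          ≡⟨ cong (if_then monomial x blockType else 0ℚ) (dec-true (weight blockType ℕ.≟ n) weight≡n) ⟩
        monomial x blockType
          ≡⟨ monomial-blockType ⟩
        Πℚ (allFin k) (λ j → monomialContribution (blockSize f j))
          ≡⟨ ℚ*.∑-cong (allFin k) (λ j → monomialContribution-within (surj j) (b≤r j)) ⟩
        fibreWeight (λ _ → φ) f  ∎
        where
        open ≡-Reasoning
        weight≡n : weight blockType ≡ n
        weight≡n = trans weight-blockType
                         (trans (ℕ+.∑-cong (allFin k) (λ j → weightContribution-within (surj j) (b≤r j))) ∑-blockSize)
      -- A block larger than r does not contribute to the weight, which therefore falls short of n.
      bounded (no ¬b≤r) =
        let (j , bj≰r) = ¬∀⟶∃¬ k _ (λ j → blockSize f j ℕ.≤? r) ¬b≤r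
            weight<n : weight blockType < n
            weight<n = ℕ.<-≤-trans
              (ℕ.≤-<-trans (ℕ.≤-reflexive weight-blockType)
                           (∑-mono-< (weightContribution≤ ∘ blockSize f) (∈-allFin j)
                                     (ℕ.≤-<-trans (ℕ.≤-reflexive (weightContribution-beyond (ℕ.≰⇒> bj≰r))) (surj j))))
              (ℕ.≤-reflexive ∑-blockSize)
        in trans (cong (if_then monomial x blockType else 0ℚ) (dec-false (weight blockType ℕ.≟ n) (ℕ.<⇒≢ weight<n)))
                 (sym (fibreWeight-vanishes j (blockWeight-beyond r x (ℕ.≰⇒> bj≰r))))

    ∑-compositionsVec-isPrefOrdering : k ≤ n →
      Σℚ (compositionsVec r n) (λ α → if does (isPrefOrdering? α f) then monomial x α else 0ℚ)
        ≡ fibreWeight (λ _ → φ) f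
    ∑-compositionsVec-isPrefOrdering k≤n = begin
      Σℚ (compositionsVec r n) (λ α → if does (isPrefOrdering? α f) then monomial x α else 0ℚ)
        ≡⟨ ℚ+.∑-cong (compositionsVec r n) (λ α → if-∧ (does surj?)) ⟩
      Σℚ (compositionsVec r n) (λ α → if does surj? then (if does (ofType? α) then monomial x α else 0ℚ) else 0ℚ)
        ≡⟨ ℚ+.∑-if (does surj?) (compositionsVec r n) (λ α → if does (ofType? α) then monomial x α else 0ℚ) ⟩
      (if does surj? then Σℚ (compositionsVec r n) (λ α → if does (ofType? α) then monomial x α else 0ℚ) else 0ℚ)
        ≡⟨ cong (if does surj? then_else 0ℚ)
                (ℚ+.∑-compositionsVec-select r n blockType (λ i → ℕ.≤-trans (blockType≤ i) k≤n)
                                             (monomial x) (monomial-cong x)) ⟩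
      (if does surj? then (if does (weight blockType ℕ.≟ n) then monomial x blockType else 0ℚ) else 0ℚ)
        ≡⟨ surjective-of-type≡fibreWeight surj? ⟩
      fibreWeight (λ _ → φ) f  ∎
      where
      open ≡-Reasoning
      surj? : Dec (∀ j → 1 ≤ blockSize f j)
      surj? = all? (λ j → 1 ℕ.≤? blockSize f j)
      ofType? : (α : Fin r → ℕ) → Dec (∀ i → blockType i ≡ α i)
      ofType? α = all? (λ i → blockType i ℕ.≟ α i)

toℚ-length-filter : {X : Set} {P : X → Set} (P? : Decidable P) (xs : List X) →
                    toℚ (length (filter P? xs)) ≡ Σℚ xs (λ a → if does (P? a) then 1ℚ else 0ℚ)
toℚ-length-filter P? xs = trans (toℚ-∑ (filter P? xs) (λ _ → 1)) (ℚ+.∑-filter P? xs (λ _ → 1ℚ))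

toℚ-𝒪 : ∀ n {r} (α : Fin r → ℕ) →
        toℚ (𝒪 n α) ≡
        ℚ+.∑< (suc n) (λ k → Σℚ (allFuns n k) (λ f → if does (isPrefOrdering? α f) then 1ℚ else 0ℚ))
toℚ-𝒪 n α = begin
  toℚ (foldr ℕ._+_ 0 (map count (upTo (suc n))))
    ≡⟨ cong toℚ (ℕ+.foldr-map≡∑ count (upTo (suc n))) ⟩
  toℚ (ℕ+.∑ (upTo (suc n)) count)
    ≡⟨ toℚ-∑ (upTo (suc n)) count ⟩
  Σℚ (upTo (suc n)) (toℚ ∘ count)
    ≡⟨ ℚ+.∑-applyUpTo id (suc n) (toℚ ∘ count) ⟩
  ℚ+.∑< (suc n) (toℚ ∘ count)
    ≡⟨ ℚ+.∑<-cong (suc n) (λ k _ → toℚ-length-filter (isPrefOrdering? α) (allFuns n k)) ⟩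
  ℚ+.∑< (suc n) (λ k → Σℚ (allFuns n k) (λ f → if does (isPrefOrdering? α f) then 1ℚ else 0ℚ))  ∎
  where
  open ≡-Reasoning
  count : ℕ → ℕ
  count k = length (filter (isPrefOrdering? α) (allFuns n k))

∑-𝒪-monomial : ∀ r (x : Fin r → ℚ) n →
               Σℚ (compositionsVec r n) (λ α → toℚ (𝒪 n α) ℚ.* monomial x α)
                 ≡ ℚ+.∑< (suc n) (λ k → Σℚ (allFuns n k) (fibreWeight (λ _ → blockWeight r x)))
∑-𝒪-monomial r x n = begin
  Σℚ CV (λ α → toℚ (𝒪 n α) ℚ.* monomial x α)
    ≡⟨ ℚ+.∑-cong CV (λ α → trans (ℚ.*-comm (toℚ (𝒪 n α)) (monomial x α))
                                 (cong (monomial x α ℚ.*_) (toℚ-𝒪 n α))) ⟩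
  Σℚ CV (λ α → monomial x α ℚ.* ℚ+.∑< (suc n) (λ k → Σℚ (allFuns n k) (λ f → 𝟙 α f)))
    ≡⟨ ℚ+.∑-cong CV (λ α → trans (*-distribˡ-Σℚ< (monomial x α) (suc n) (λ k → Σℚ (allFuns n k) (𝟙 α)))
                                 (ℚ+.∑<-cong (suc n) (λ k _ → trans (*-distribˡ-Σℚ (monomial x α) (allFuns n k) (𝟙 α))
                                                                    (ℚ+.∑-cong (allFuns n k) (selects α))))) ⟩
  Σℚ CV (λ α → ℚ+.∑< (suc n) (λ k → Σℚ (allFuns n k) (λ f → term α f)))
    ≡⟨ ℚ+.∑<-∑-comm (suc n) CV (λ k α → Σℚ (allFuns n k) (term α)) ⟨
  ℚ+.∑< (suc n) (λ k → Σℚ CV (λ α → Σℚ (allFuns n k) (term α)))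
    ≡⟨ ℚ+.∑<-cong (suc n) (λ k _ → ℚ+.∑-comm CV (allFuns n k) (λ α → term α)) ⟩
  ℚ+.∑< (suc n) (λ k → Σℚ (allFuns n k) (λ f → Σℚ CV (λ α → term α f)))
    ≡⟨ ℚ+.∑<-cong (suc n) (λ k k<1+n → ℚ+.∑-cong (allFuns n k)
                            (λ f → BlockStatistics.∑-compositionsVec-isPrefOrdering r x f (ℕ.≤-pred k<1+n))) ⟩
  ℚ+.∑< (suc n) (λ k → Σℚ (allFuns n k) (fibreWeight (λ _ → blockWeight r x)))  ∎
  where
  open ≡-Reasoning
  CV : List (Fin r → ℕ)
  CV = compositionsVec r n
  𝟙 term : (Fin r → ℕ) → ∀ {k} → (Fin n → Fin k) → ℚ
  𝟙 α f = if does (isPrefOrdering? α f) then 1ℚ else 0ℚ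
  term α f = if does (isPrefOrdering? α f) then monomial x α else 0ℚ
  selects : ∀ α {k} (f : Fin n → Fin k) → monomial x α ℚ.* 𝟙 α f ≡ term α f
  selects α f = trans (if-float (monomial x α ℚ.*_) (does (isPrefOrdering? α f)))
                      (cong₂ (if does (isPrefOrdering? α f) then_else_)
                             (ℚ.*-identityʳ (monomial x α)) (ℚ.*-zeroʳ (monomial x α)))

-- The identity also holds for n = 0.
theorem4p7 : (r n : ℕ) → 1 ≤ r → 1 ≤ n → (x : Fin r → ℚ) →
    toℚ (n !) ℚ.* Fib r (λ i → invFact (suc (toℕ i)) ℚ.* x i) (n ℕ.+ r ∸ 1)
      ≡ Σℚ (compositionsVec r n) (λ α → toℚ (𝒪 n α) ℚ.* monomial x α)
theorem4p7 (suc r′) n _ _ x = begin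
  toℚ (n !) ℚ.* Fib (suc r′) y (n ℕ.+ suc r′ ∸ 1)
    ≡⟨ cong (λ m → toℚ (n !) ℚ.* Fib (suc r′) y (m ∸ 1)) (ℕ.+-suc n r′) ⟩
  scaledFib n
    ≡⟨ renewal-unique φ refl scaledFib-renewal (⋆-geometric-renewal φ refl) n ⟩
  ⋆-geometric φ n
    ≡⟨ ℚ+.∑<-cong (suc n) (λ k _ → ∑-fibreWeight≡∏⋆ n {k} (λ _ → φ)) ⟨
  ℚ+.∑< (suc n) (λ k → Σℚ (allFuns n k) (fibreWeight (λ _ → φ)))
    ≡⟨ ∑-𝒪-monomial (suc r′) x n ⟨
  Σℚ (compositionsVec (suc r′) n) (λ α → toℚ (𝒪 n α) ℚ.* monomial x α)  ∎
  where
  open ≡-Reasoning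
  open ScaledFibonacci r′ x
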